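{- Let $R$ be a commutative ring with $1$, $\mathcal{A}$ a set of non-commuting symbols, $D_{\mathcal{A}}(p,q)=1+\sum_{\emptyset\neq w}D^w(p,q)w$ an $R$-valued multiple Dedekind symbol based on $\mathcal{A}$ and $F_{\mathcal{A}}(p,q)=D_{\mathcal{A}}(p,q)D_{\mathcal{A}}(-q,p)^{ -1}=1+\sum_{\emptyset\neq w}F^w(p,q)w$ its associated function. Then for all non-empty words $u,v\in\mathcal{A}^*$ and all $(p,q)\in U$, $$\sum_{w\in Sh(u,v)}D^{w}(p,q)=\sum_{u_{1}u_{2}=u,\ v_{1}v_{2}=v}\Big[\sum_{w_{1}\in Sh(u_{1},v_{1})}F^{w_{1}}(p,q)\sum_{w_{2}\in Sh(u_{2},v_{2})}D^{w_{2}}(-q,p)\Big],$$ where the outer sum runs over all factorizations $u=u_1u_2$, $v=v_1v_2$ into (possibly empty) words.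
   Context: $\mathcal{A}^*$ is the set of words in $\mathcal{A}$ (including $\emptyset$) with concatenation; $R\langle\langle\mathcal{A}\rangle\rangle$ is the ring of non-commutative formal power series $\sum_{w\in\mathcal{A}^*}c_ww$ with unit group $R\langle\langle\mathcal{A}\rangle\rangle^\times$; $U=\{(p,q)\in\mathbb{Z}^2:\gcd(p,q)=1\}$. An $R$-valued multiple Dedekind symbol based on $\mathcal{A}$ is a map $D:U\to R\langle\langle\mathcal{A}\rangle\rangle^\times$ of the form $1+\sum_{w\neq\emptyset}D^w(p,q)w$ with $D(p,-q)=D(-p,q)$ and $D(p,q)=D(p,p+q)$. Conventions: $D^{\emptyset}=F^{\emptyset}=1$. For words $u=a_1\cdots a_r$, $v=a_{r+1}\cdots a_{r+s}$ (letters $a_j\in\mathcal{A}$), $Sh(u,v)$ is the multiset of words $a_{\sigma^{ -1}(1)}\cdots a_{\sigma^{ -1}(r+s)}$, one for each permutation $\sigma$ of $\{1,\dots,r+s\}$ with $\sigma(1)<\dots<\sigma(r)$ and $\sigma(r+1)<\dots<\sigma(r+s)$; sums over $Sh(u,v)$ are taken with multiplicity. In particular $Sh(u,\emptyset)=\{u\}$, $Sh(\emptyset,v)=\{v\}$, $Sh(\emptyset,\emptyset)=\{\emptyset\}$. -}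

module Defs where

open import Level using (Level; _⊔_)
open import Algebra.Bundles using (CommutativeRing)
open import Data.List using (List; []; _∷_; map; _++_; foldr)
open import Data.Product using (_×_; _,_)
open import Data.Integer using (ℤ; -_; _+_)
open import Data.Integer.Coprimality using (Coprime)

-- Shuffle product Sh(u,v), as a list of words (a multiset, with multiplicity).
Sh : ∀ {a} {A : Set a} → List A → List A → List (List A)
Sh []       v        = v ∷ []
Sh (x ∷ u)  []       = (x ∷ u) ∷ []
Sh (x ∷ u)  (y ∷ v)  = map (x ∷_) (Sh u (y ∷ v)) ++ map (y ∷_) (Sh (x ∷ u) v)

splits : ∀ {a} {A : Set a} → List A → List (List A × List A)
splits []       = ([] , []) ∷ []
splits (x ∷ w)  = ([] , x ∷ w) ∷ map (λ { (w₁ , w₂) → (x ∷ w₁ , w₂) }) (splits w)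

module _ {c ℓ} (R : CommutativeRing c ℓ) {a} (A : Set a) where
  open CommutativeRing R using (_≈_; 0#; 1#) renaming (Carrier to K; _+_ to _⊕_; _*_ to _⊛_)

  Series : Set (a ⊔ c)
  Series = List A → K

  Σ : List K → K
  Σ = foldr _⊕_ 0#

  one : Series
  one []      = 1#
  one (_ ∷ _) = 0#

  mul : Series → Series → Series
  mul f g w = Σ (map (λ { (w₁ , w₂) → f w₁ ⊛ g w₂ }) (splits w))

  _≋_ : Series → Series → Set (a ⊔ ℓ)
  f ≋ g = ∀ w → f w ≈ g w

  -- D is given on ℤ × ℤ, only its values on U = {(p,q) | gcd(p,q)=1} matter;
  -- Dinv p q is the (two-sided) inverse of D p q in R⟨⟨A⟩⟩, witnessing that
  -- D takes values in the unit group.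
  record IsMultipleDedekindSymbol (D Dinv : ℤ → ℤ → Series) : Set (a ⊔ ℓ) where
    field
      const-one  : ∀ p q → Coprime p q → D p q [] ≈ 1#
      inverseˡ   : ∀ p q → Coprime p q → mul (Dinv p q) (D p q) ≋ one
      inverseʳ   : ∀ p q → Coprime p q → mul (D p q) (Dinv p q) ≋ one
      sym-sign   : ∀ p q → Coprime p q → D p (- q) ≋ D (- p) q
      translate  : ∀ p q → Coprime p q → D p q ≋ D p (p + q)

  assocF : (D Dinv : ℤ → ℤ → Series) → ℤ → ℤ → Series
  assocF D Dinv p q = mul (D p q) (Dinv (- q) p)

  shSum : Series → List A → List A → K
  shSum f u v = Σ (map f (Sh u v))

-- Shuffle sums turn products of series into "convolutions": for any series f, g,
--   Σ_{w ∈ Sh(u,v)} (f g)^w = Σ_{u = u₁u₂, v = v₁v₂} (Σ_{Sh(u₁,v₁)} f) (Σ_{Sh(u₂,v₂)} g).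
-- Both sides obey the same recursion under peeling off the first letters x, y of u, v,
-- since the left quotient by a letter satisfies ∂ₓ(f g) = f^∅ ∂ₓ g + (∂ₓ f) g and
-- Sh(xu, yv) = x Sh(u, yv) ∪ y Sh(xu, v). The theorem is the case f = F(p,q),
-- g = D(-q,p), where f g = D(p,q) D(-q,p)⁻¹ D(-q,p) = D(p,q).
module Submission where

open import Defs
open import Algebra.Bundles using (CommutativeRing)
open import Data.List using (List; []; _∷_; map; _++_)
open import Data.Product using (_×_; _,_)
open import Data.Integer using (ℤ; -_; ∣_∣)
open import Data.Integer.Properties using (∣-i∣≡∣i∣)
open import Data.Integer.Coprimality using (Coprime)
import Data.Integer.Coprimality as Coprime
import Data.Nat.Coprimality as ℕ
open import Relation.Binary.PropositionalEquality using (_≢_; subst)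
import Relation.Binary.PropositionalEquality as ≡

coprime-neg-swap : ∀ {p q} → Coprime p q → Coprime (- q) p
coprime-neg-swap {p} {q} cop =
  subst (λ n → ℕ.Coprime n ∣ p ∣) (≡.sym (∣-i∣≡∣i∣ q)) (Coprime.sym {p} {q} cop)

module ShuffleAlgebra {c ℓ} (R : CommutativeRing c ℓ) {a} (A : Set a) where
  open CommutativeRing R hiding (-_) renaming (Carrier to K)
  open import Algebra.Properties.CommutativeSemigroup +-commutativeSemigroup
    using (interchange; x∙yz≈y∙xz)
  open import Relation.Binary.Reasoning.Setoid setoid

  ∑ : List K → K
  ∑ = Σ R A

  _⋆_ : Series R A → Series R A → Series R A
  _⋆_ = mul R A

  sh : Series R A → List A → List A → K
  sh = shSum R A

  ∂ : A → Series R A → Series R A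
  ∂ x f w = f (x ∷ w)

  module _ {b} {B : Set b} where

    ∑-map-cong : ∀ {h k : B → K} xs → (∀ x → h x ≈ k x) → ∑ (map h xs) ≈ ∑ (map k xs)
    ∑-map-cong []       h≈k = refl
    ∑-map-cong (x ∷ xs) h≈k = +-cong (h≈k x) (∑-map-cong xs h≈k)

    ∑-map-+ : ∀ (h k : B → K) xs → ∑ (map (λ x → h x + k x) xs) ≈ ∑ (map h xs) + ∑ (map k xs)
    ∑-map-+ h k []       = sym (+-identityʳ 0#)
    ∑-map-+ h k (x ∷ xs) = trans (+-cong refl (∑-map-+ h k xs)) (interchange _ _ _ _)

    ∑-map-*ˡ : ∀ c (h : B → K) xs → ∑ (map (λ x → c * h x) xs) ≈ c * ∑ (map h xs)
    ∑-map-*ˡ c h []       = sym (zeroʳ c)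
    ∑-map-*ˡ c h (x ∷ xs) = trans (+-cong refl (∑-map-*ˡ c h xs)) (sym (distribˡ c _ _))

    ∑-map-++ : ∀ (h : B → K) xs ys → ∑ (map h (xs ++ ys)) ≈ ∑ (map h xs) + ∑ (map h ys)
    ∑-map-++ h []       ys = sym (+-identityˡ _)
    ∑-map-++ h (x ∷ xs) ys = trans (+-cong refl (∑-map-++ h xs ys)) (sym (+-assoc _ _ _))

    ∑-map-map : ∀ {d} {C : Set d} {h : C → K} {k : B → C} {j : B → K} xs →
                (∀ x → h (k x) ≈ j x) → ∑ (map h (map k xs)) ≈ ∑ (map j xs)
    ∑-map-map []       hk≈j = refl
    ∑-map-map (x ∷ xs) hk≈j = +-cong (hk≈j x) (∑-map-map xs hk≈j)

  ∑-splits-∷ : ∀ (h : List A × List A → K) x w →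
    ∑ (map h (splits (x ∷ w))) ≈ h ([] , x ∷ w) + ∑ (map (λ { (w₁ , w₂) → h (x ∷ w₁ , w₂) }) (splits w))
  ∑-splits-∷ h x w = +-cong refl (∑-map-map (splits w) λ _ → refl)

  mul-[] : ∀ f g → (f ⋆ g) [] ≈ f [] * g []
  mul-[] f g = +-identityʳ _

  ∂-mul : ∀ f g x w → ∂ x (f ⋆ g) w ≈ f [] * ∂ x g w + (∂ x f ⋆ g) w
  ∂-mul f g x w = ∑-splits-∷ (λ { (w₁ , w₂) → f w₁ * g w₂ }) x w

  mul-cong : ∀ {f f′ g g′} → (∀ w → f w ≈ f′ w) → (∀ w → g w ≈ g′ w) → ∀ w → (f ⋆ g) w ≈ (f′ ⋆ g′) w
  mul-cong f≈f′ g≈g′ w = ∑-map-cong (splits w) λ { (w₁ , w₂) → *-cong (f≈f′ w₁) (g≈g′ w₂) }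

  mul-distribʳ-+ : ∀ f f′ g w → ((λ w → f w + f′ w) ⋆ g) w ≈ (f ⋆ g) w + (f′ ⋆ g) w
  mul-distribʳ-+ f f′ g w =
    trans (∑-map-cong (splits w) λ { (w₁ , w₂) → distribʳ (g w₂) (f w₁) (f′ w₁) })
          (∑-map-+ (λ { (w₁ , w₂) → f w₁ * g w₂ }) (λ { (w₁ , w₂) → f′ w₁ * g w₂ }) (splits w))

  mul-scaleˡ : ∀ c f g w → ((λ w → c * f w) ⋆ g) w ≈ c * (f ⋆ g) w
  mul-scaleˡ c f g w =
    trans (∑-map-cong (splits w) λ { (w₁ , w₂) → *-assoc c (f w₁) (g w₂) })
          (∑-map-*ˡ c (λ { (w₁ , w₂) → f w₁ * g w₂ }) (splits w))

  mul-assoc : ∀ f g h w → ((f ⋆ g) ⋆ h) w ≈ (f ⋆ (g ⋆ h)) w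
  mul-assoc f g h [] = begin
    ((f ⋆ g) ⋆ h) []         ≈⟨ trans (mul-[] (f ⋆ g) h) (*-cong (mul-[] f g) refl) ⟩
    (f [] * g []) * h []     ≈⟨ *-assoc _ _ _ ⟩
    f [] * (g [] * h [])     ≈⟨ sym (trans (mul-[] f (g ⋆ h)) (*-cong refl (mul-[] g h))) ⟩
    (f ⋆ (g ⋆ h)) []         ∎
  mul-assoc f g h (x ∷ w) = begin
    ((f ⋆ g) ⋆ h) (x ∷ w)
      ≈⟨ ∂-mul (f ⋆ g) h x w ⟩
    (f ⋆ g) [] * h (x ∷ w) + (∂ x (f ⋆ g) ⋆ h) w
      ≈⟨ +-cong (*-cong (mul-[] f g) refl) (mul-cong (∂-mul f g x) (λ _ → refl) w) ⟩
    (f [] * g []) * h (x ∷ w) + ((λ w′ → f [] * ∂ x g w′ + (∂ x f ⋆ g) w′) ⋆ h) w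
      ≈⟨ +-cong (*-assoc _ _ _) (mul-distribʳ-+ _ _ h w) ⟩
    f [] * (g [] * h (x ∷ w)) + (((λ w′ → f [] * ∂ x g w′) ⋆ h) w + ((∂ x f ⋆ g) ⋆ h) w)
      ≈⟨ +-cong refl (+-cong (mul-scaleˡ (f []) (∂ x g) h w) (mul-assoc (∂ x f) g h w)) ⟩
    f [] * (g [] * h (x ∷ w)) + (f [] * (∂ x g ⋆ h) w + (∂ x f ⋆ (g ⋆ h)) w)
      ≈⟨ sym (+-assoc _ _ _) ⟩
    (f [] * (g [] * h (x ∷ w)) + f [] * (∂ x g ⋆ h) w) + (∂ x f ⋆ (g ⋆ h)) w
      ≈⟨ +-cong (trans (sym (distribˡ _ _ _)) (*-cong refl (sym (∂-mul g h x w)))) refl ⟩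
    f [] * (g ⋆ h) (x ∷ w) + (∂ x f ⋆ (g ⋆ h)) w
      ≈⟨ sym (∂-mul f (g ⋆ h) x w) ⟩
    (f ⋆ (g ⋆ h)) (x ∷ w) ∎

  mul-identityʳ : ∀ f w → (f ⋆ one R A) w ≈ f w
  mul-identityʳ f []      = trans (mul-[] f (one R A)) (*-identityʳ _)
  mul-identityʳ f (x ∷ w) = begin
    (f ⋆ one R A) (x ∷ w)               ≈⟨ ∂-mul f (one R A) x w ⟩
    f [] * 0# + (∂ x f ⋆ one R A) w     ≈⟨ +-cong (zeroʳ _) (mul-identityʳ (∂ x f) w) ⟩
    0# + f (x ∷ w)                      ≈⟨ +-identityˡ _ ⟩
    f (x ∷ w)                           ∎

  sh-[]ˡ : ∀ h v → sh h [] v ≈ h v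
  sh-[]ˡ h v = +-identityʳ _

  sh-[]ʳ : ∀ h u → sh h u [] ≈ h u
  sh-[]ʳ h []      = +-identityʳ _
  sh-[]ʳ h (x ∷ u) = +-identityʳ _

  sh-∷-∷ : ∀ h x u y v → sh h (x ∷ u) (y ∷ v) ≈ sh (∂ x h) u (y ∷ v) + sh (∂ y h) (x ∷ u) v
  sh-∷-∷ h x u y v =
    trans (∑-map-++ h (map (x ∷_) (Sh u (y ∷ v))) (map (y ∷_) (Sh (x ∷ u) v)))
          (+-cong (∑-map-map (Sh u (y ∷ v)) λ _ → refl) (∑-map-map (Sh (x ∷ u) v) λ _ → refl))

  sh-cong : ∀ {h k} u v → (∀ w → h w ≈ k w) → sh h u v ≈ sh k u v
  sh-cong u v = ∑-map-cong (Sh u v)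

  sh-∂-mul : ∀ f g x u v → sh (∂ x (f ⋆ g)) u v ≈ f [] * sh (∂ x g) u v + sh (∂ x f ⋆ g) u v
  sh-∂-mul f g x u v = begin
    sh (∂ x (f ⋆ g)) u v                                   ≈⟨ sh-cong u v (∂-mul f g x) ⟩
    sh (λ w → f [] * ∂ x g w + (∂ x f ⋆ g) w) u v          ≈⟨ ∑-map-+ _ _ (Sh u v) ⟩
    sh (λ w → f [] * ∂ x g w) u v + sh (∂ x f ⋆ g) u v     ≈⟨ +-cong (∑-map-*ˡ (f []) (∂ x g) (Sh u v)) refl ⟩
    f [] * sh (∂ x g) u v + sh (∂ x f ⋆ g) u v             ∎

  sh-mul-∷-∷ : ∀ f g x u y v → sh (f ⋆ g) (x ∷ u) (y ∷ v) ≈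
    f [] * sh g (x ∷ u) (y ∷ v) + (sh (∂ x f ⋆ g) u (y ∷ v) + sh (∂ y f ⋆ g) (x ∷ u) v)
  sh-mul-∷-∷ f g x u y v = begin
    sh (f ⋆ g) (x ∷ u) (y ∷ v)
      ≈⟨ sh-∷-∷ (f ⋆ g) x u y v ⟩
    sh (∂ x (f ⋆ g)) u (y ∷ v) + sh (∂ y (f ⋆ g)) (x ∷ u) v
      ≈⟨ +-cong (sh-∂-mul f g x u (y ∷ v)) (sh-∂-mul f g y (x ∷ u) v) ⟩
    (f [] * sh (∂ x g) u (y ∷ v) + sh (∂ x f ⋆ g) u (y ∷ v)) + (f [] * sh (∂ y g) (x ∷ u) v + sh (∂ y f ⋆ g) (x ∷ u) v)
      ≈⟨ interchange _ _ _ _ ⟩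
    (f [] * sh (∂ x g) u (y ∷ v) + f [] * sh (∂ y g) (x ∷ u) v) + (sh (∂ x f ⋆ g) u (y ∷ v) + sh (∂ y f ⋆ g) (x ∷ u) v)
      ≈⟨ +-cong (trans (sym (distribˡ _ _ _)) (*-cong refl (sym (sh-∷-∷ g x u y v)))) refl ⟩
    f [] * sh g (x ∷ u) (y ∷ v) + (sh (∂ x f ⋆ g) u (y ∷ v) + sh (∂ y f ⋆ g) (x ∷ u) v) ∎

  convRow : Series R A → Series R A → List A → List A → List A → K
  convRow f g u₁ u₂ v = ∑ (map (λ { (v₁ , v₂) → sh f u₁ v₁ * sh g u₂ v₂ }) (splits v))

  conv : Series R A → Series R A → List A → List A → K
  conv f g u v = ∑ (map (λ { (u₁ , u₂) → convRow f g u₁ u₂ v }) (splits u))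

  convRow-[]-∷ : ∀ f g u₂ y v →
    convRow f g [] u₂ (y ∷ v) ≈ f [] * sh g u₂ (y ∷ v) + convRow (∂ y f) g [] u₂ v
  convRow-[]-∷ f g u₂ y v =
    trans (∑-splits-∷ _ y v)
          (+-cong (*-cong (sh-[]ˡ f []) refl)
                  (∑-map-cong (splits v) λ { (v₁ , v₂) → *-cong (trans (sh-[]ˡ f (y ∷ v₁)) (sym (sh-[]ˡ (∂ y f) v₁))) refl }))

  convRow-∷-∷ : ∀ f g x u₁ u₂ y v →
    convRow f g (x ∷ u₁) u₂ (y ∷ v) ≈ convRow (∂ x f) g u₁ u₂ (y ∷ v) + convRow (∂ y f) g (x ∷ u₁) u₂ v
  convRow-∷-∷ f g x u₁ u₂ y v = begin
    convRow f g (x ∷ u₁) u₂ (y ∷ v)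
      ≈⟨ ∑-splits-∷ _ y v ⟩
    sh f (x ∷ u₁) [] * sh g u₂ (y ∷ v) + ∑ (map (λ { (v₁ , v₂) → sh f (x ∷ u₁) (y ∷ v₁) * sh g u₂ v₂ }) (splits v))
      ≈⟨ +-cong (*-cong (trans (sh-[]ʳ f (x ∷ u₁)) (sym (sh-[]ʳ (∂ x f) u₁))) refl)
                (trans (∑-map-cong (splits v) λ { (v₁ , v₂) → trans (*-cong (sh-∷-∷ f x u₁ y v₁) refl) (distribʳ _ _ _) })
                       (∑-map-+ (λ { (v₁ , v₂) → sh (∂ x f) u₁ (y ∷ v₁) * sh g u₂ v₂ }) _ (splits v))) ⟩
    sh (∂ x f) u₁ [] * sh g u₂ (y ∷ v) + (∑ (map (λ { (v₁ , v₂) → sh (∂ x f) u₁ (y ∷ v₁) * sh g u₂ v₂ }) (splits v))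
                                           + convRow (∂ y f) g (x ∷ u₁) u₂ v)
      ≈⟨ trans (sym (+-assoc _ _ _)) (+-cong (sym (∑-splits-∷ _ y v)) refl) ⟩
    convRow (∂ x f) g u₁ u₂ (y ∷ v) + convRow (∂ y f) g (x ∷ u₁) u₂ v ∎

  conv-∷-∷ : ∀ f g x u y v → conv f g (x ∷ u) (y ∷ v) ≈
    f [] * sh g (x ∷ u) (y ∷ v) + (conv (∂ x f) g u (y ∷ v) + conv (∂ y f) g (x ∷ u) v)
  conv-∷-∷ f g x u y v = begin
    conv f g (x ∷ u) (y ∷ v)
      ≈⟨ ∑-splits-∷ _ x u ⟩
    convRow f g [] (x ∷ u) (y ∷ v) + ∑ (map (λ { (u₁ , u₂) → convRow f g (x ∷ u₁) u₂ (y ∷ v) }) (splits u))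
      ≈⟨ +-cong (convRow-[]-∷ f g (x ∷ u) y v)
                (trans (∑-map-cong (splits u) λ { (u₁ , u₂) → convRow-∷-∷ f g x u₁ u₂ y v }) (∑-map-+ _ _ (splits u))) ⟩
    (f [] * sh g (x ∷ u) (y ∷ v) + P) + (conv (∂ x f) g u (y ∷ v) + T)
      ≈⟨ trans (+-assoc _ _ _) (+-cong refl (x∙yz≈y∙xz P _ T)) ⟩
    f [] * sh g (x ∷ u) (y ∷ v) + (conv (∂ x f) g u (y ∷ v) + (P + T))
      ≈⟨ +-cong refl (+-cong refl (sym (∑-splits-∷ _ x u))) ⟩
    f [] * sh g (x ∷ u) (y ∷ v) + (conv (∂ x f) g u (y ∷ v) + conv (∂ y f) g (x ∷ u) v) ∎
    where
      P = convRow (∂ y f) g [] (x ∷ u) v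
      T = ∑ (map (λ { (u₁ , u₂) → convRow (∂ y f) g (x ∷ u₁) u₂ v }) (splits u))

  sh-mul : ∀ f g u v → sh (f ⋆ g) u v ≈ conv f g u v
  sh-mul f g [] v = begin
    sh (f ⋆ g) [] v         ≈⟨ sh-[]ˡ (f ⋆ g) v ⟩
    (f ⋆ g) v               ≈⟨ ∑-map-cong (splits v) (λ { (v₁ , v₂) → *-cong (sym (sh-[]ˡ f v₁)) (sym (sh-[]ˡ g v₂)) }) ⟩
    convRow f g [] [] v     ≈⟨ sym (+-identityʳ _) ⟩
    conv f g [] v           ∎
  sh-mul f g (x ∷ u) [] = begin
    sh (f ⋆ g) (x ∷ u) []   ≈⟨ sh-[]ʳ (f ⋆ g) (x ∷ u) ⟩
    (f ⋆ g) (x ∷ u)         ≈⟨ ∑-map-cong (splits (x ∷ u)) (λ { (u₁ , u₂) →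
                                 trans (*-cong (sym (sh-[]ʳ f u₁)) (sym (sh-[]ʳ g u₂))) (sym (+-identityʳ _)) }) ⟩
    conv f g (x ∷ u) []     ∎
  sh-mul f g (x ∷ u) (y ∷ v) = begin
    sh (f ⋆ g) (x ∷ u) (y ∷ v)
      ≈⟨ sh-mul-∷-∷ f g x u y v ⟩
    f [] * sh g (x ∷ u) (y ∷ v) + (sh (∂ x f ⋆ g) u (y ∷ v) + sh (∂ y f ⋆ g) (x ∷ u) v)
      ≈⟨ +-cong refl (+-cong (sh-mul (∂ x f) g u (y ∷ v)) (sh-mul (∂ y f) g (x ∷ u) v)) ⟩
    f [] * sh g (x ∷ u) (y ∷ v) + (conv (∂ x f) g u (y ∷ v) + conv (∂ y f) g (x ∷ u) v)
      ≈⟨ sym (conv-∷-∷ f g x u y v) ⟩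
    conv f g (x ∷ u) (y ∷ v) ∎

  module _ {D Dinv : ℤ → ℤ → Series R A} (isD : IsMultipleDedekindSymbol R A D Dinv) where
    open IsMultipleDedekindSymbol isD

    assocF-mul : ∀ {p q} → Coprime p q → ∀ w → (assocF R A D Dinv p q ⋆ D (- q) p) w ≈ D p q w
    assocF-mul {p} {q} cop w = begin
      ((D p q ⋆ Dinv (- q) p) ⋆ D (- q) p) w   ≈⟨ mul-assoc _ _ _ w ⟩
      (D p q ⋆ (Dinv (- q) p ⋆ D (- q) p)) w   ≈⟨ mul-cong (λ _ → refl) (inverseˡ (- q) p (coprime-neg-swap {p} {q} cop)) w ⟩
      (D p q ⋆ one R A) w                      ≈⟨ mul-identityʳ _ w ⟩
      D p q w                                  ∎

lemma4p9 : ∀ {c ℓ a} (R : CommutativeRing c ℓ) (A : Set a)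
    (D Dinv : ℤ → ℤ → Series R A) →
    IsMultipleDedekindSymbol R A D Dinv →
    (u v : List A) → u ≢ [] → v ≢ [] →
    (p q : ℤ) → Coprime p q →
    CommutativeRing._≈_ R
      (shSum R A (D p q) u v)
      (Σ R A (map (λ { (u₁ , u₂) → Σ R A (map (λ { (v₁ , v₂) →
          CommutativeRing._*_ R
            (shSum R A (assocF R A D Dinv p q) u₁ v₁)
            (shSum R A (D (- q) p) u₂ v₂) }) (splits v)) }) (splits u)))
lemma4p9 R A D Dinv isD u v _ _ p q cop = begin
  sh (D p q) u v                                   ≈⟨ sh-cong u v (λ w → sym (assocF-mul isD cop w)) ⟩
  sh (assocF R A D Dinv p q ⋆ D (- q) p) u v       ≈⟨ sh-mul _ _ u v ⟩
  conv (assocF R A D Dinv p q) (D (- q) p) u v     ∎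
  where
    open CommutativeRing R using (sym)
    open ShuffleAlgebra R A
    open import Relation.Binary.Reasoning.Setoid (CommutativeRing.setoid R)
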